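{- Let $\mathfrak F=(W,R_h,R_v)$ be a rooted frame in which $R_h$ and $R_v$ are commuting pseudo-equivalence relations. Then $\mathfrak F$ can be represented as a grid of bi-clusters, i.e. there are sets $X,Y$ and a bijection $g:X\times Y\to W^\sim$ such that for all $x\ne x'\in X$ and $y\ne y'\in Y$: $uR_hv$ for all $u\in g(x,y)$, $v\in g(x',y)$; and $uR_vv$ for all $u\in g(x,y)$, $v\in g(x,y')$.
   Context: A pseudo-equivalence relation is a symmetric relation $R$ that is pseudo-transitive: $xRy\wedge yRz\to(x=z\vee xRz)$. $R_h,R_v$ commute means $R_h\circ R_v=R_v\circ R_h$. A frame is rooted if some point reaches all points via the reflexive transitive closure of $R_h\cup R_v$. Let $R_h^+,R_v^+$ be the reflexive closures of $R_h,R_v$; define $u\sim v$ iff $uR_h^+v$ and $uR_v^+v$; $W^\sim$ is the set of $\sim$-classes. (Each $\sim$-class with the restricted relations is called a bi-cluster.) -}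

module Defs where

open import Level using (0ℓ)
open import Data.Product using (Σ; ∃; _×_; _,_)
open import Data.Sum using (_⊎_)
open import Relation.Binary.PropositionalEquality using (_≡_)
open import Relation.Binary.Core using (Rel)
open import Relation.Binary.Bundles using (Setoid)
open import Relation.Binary.Construct.Closure.ReflexiveTransitive using (Star)
open import Relation.Nullary using (¬_)

module _ {W : Set} where

  Symmetric : Rel W 0ℓ → Set
  Symmetric R = ∀ {x y} → R x y → R y x

  PseudoTransitive : Rel W 0ℓ → Set
  PseudoTransitive R = ∀ {x y z} → R x y → R y z → (x ≡ z) ⊎ R x z

  IsPseudoEquivalence : Rel W 0ℓ → Set
  IsPseudoEquivalence R = Symmetric R × PseudoTransitive R

  _∘ᵣ_ : Rel W 0ℓ → Rel W 0ℓ → Rel W 0ℓ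
  (R ∘ᵣ S) x z = ∃ λ y → R x y × S y z

  Commute : Rel W 0ℓ → Rel W 0ℓ → Set
  Commute R S = ∀ x z → ((R ∘ᵣ S) x z → (S ∘ᵣ R) x z) × ((S ∘ᵣ R) x z → (R ∘ᵣ S) x z)

  _∪ᵣ_ : Rel W 0ℓ → Rel W 0ℓ → Rel W 0ℓ
  (R ∪ᵣ S) x y = R x y ⊎ S x y

  Rooted : Rel W 0ℓ → Rel W 0ℓ → Set
  Rooted Rh Rv = ∃ λ r → ∀ w → Star (Rh ∪ᵣ Rv) r w

  Refl⁺ : Rel W 0ℓ → Rel W 0ℓ
  Refl⁺ R x y = (x ≡ y) ⊎ R x y

  _∼⟨_,_⟩_ : W → Rel W 0ℓ → Rel W 0ℓ → W → Set
  u ∼⟨ Rh , Rv ⟩ v = Refl⁺ Rh u v × Refl⁺ Rv u v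

-- X, Y are sets (setoids), and g : X × Y → W^∼ is a bijection, where an
-- element of W^∼ (a ∼-class) is given by a representative in W, so that
-- equality in W^∼ is ∼.
module _ {W : Set} (Rh Rv : Rel W 0ℓ) where

  private
    _∼_ : W → W → Set
    u ∼ v = u ∼⟨ Rh , Rv ⟩ v

  record GridOfBiClusters (X Y : Setoid 0ℓ 0ℓ) : Set where
    private
      module X = Setoid X
      module Y = Setoid Y
    field
      g : X.Carrier → Y.Carrier → W
      g-cong : ∀ {x x' y y'} → x X.≈ x' → y Y.≈ y' → g x y ∼ g x' y'
      g-injective : ∀ {x x' y y'} → g x y ∼ g x' y' → (x X.≈ x') × (y Y.≈ y')
      g-surjective : ∀ (w : W) → ∃ λ x → ∃ λ y → w ∼ g x y
      horizontal : ∀ {x x' y} → ¬ (x X.≈ x') →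
        ∀ {u v} → u ∼ g x y → v ∼ g x' y → Rh u v
      vertical : ∀ {x y y'} → ¬ (y Y.≈ y') →
        ∀ {u v} → u ∼ g x y → v ∼ g x y' → Rv u v

  RepresentableAsGrid : Set₁
  RepresentableAsGrid = Σ (Setoid 0ℓ 0ℓ) λ X → Σ (Setoid 0ℓ 0ℓ) λ Y → GridOfBiClusters X Y

-- Both reflexive closures R_h⁺ and R_v⁺ are equivalence relations, and since
-- R_h and R_v commute, so is their composite R_v⁺ ∘ R_h⁺. It contains
-- R_h ∪ R_v, so by rootedness it relates any two points: for all x, y there
-- is a point g(x, y) in the R_v⁺-class of x and the R_h⁺-class of y. Taking
-- X = W/R_v⁺ and Y = W/R_h⁺, the ∼-class of g(x, y) is the intersection of
-- these two classes. Two points of one row lying in different columns are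
-- distinct, hence R_h-related by pseudo-transitivity; dually for columns.
module Submission where

open import Defs
open import Level using (0ℓ)
open import Data.Empty using (⊥-elim)
open import Data.Product using (_,_; proj₁; proj₂)
open import Data.Sum using (inj₁; inj₂)
open import Function using (_∘_)
open import Relation.Binary.Bundles using (Setoid)
open import Relation.Binary.Core using (Rel; _⇒_)
open import Relation.Binary.Structures using (IsEquivalence)
open import Relation.Binary.Construct.Closure.ReflexiveTransitive using (Star; fold)
open import Relation.Binary.PropositionalEquality using (_≡_; refl; sym)
open import Relation.Nullary using (¬_)

module _ {W : Set} {R : Rel W 0ℓ} where

  Refl⁺-isEquivalence : IsPseudoEquivalence R → IsEquivalence (Refl⁺ R)
  Refl⁺-isEquivalence (R-sym , R-ptrans) = record
    { refl  = inj₁ refl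
    ; sym   = λ { (inj₁ x≡y) → inj₁ (sym x≡y) ; (inj₂ xRy) → inj₂ (R-sym xRy) }
    ; trans = λ { (inj₁ refl) q → q
                ; (inj₂ xRy) (inj₁ refl) → inj₂ xRy
                ; (inj₂ xRy) (inj₂ yRz) → R-ptrans xRy yRz }
    }

  Refl⁺-setoid : IsPseudoEquivalence R → Setoid 0ℓ 0ℓ
  Refl⁺-setoid isPE = record { isEquivalence = Refl⁺-isEquivalence isPE }

  Refl⁺∧≢⇒R : ∀ {u v} → Refl⁺ R u v → ¬ u ≡ v → R u v
  Refl⁺∧≢⇒R (inj₁ u≡v) u≢v = ⊥-elim (u≢v u≡v)
  Refl⁺∧≢⇒R (inj₂ uRv) _   = uRv

Refl⁺-commute : ∀ {W : Set} {R S : Rel W 0ℓ} → Commute R S →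
  ∀ {a b c} → Refl⁺ R a b → Refl⁺ S b c → (Refl⁺ S ∘ᵣ Refl⁺ R) a c
Refl⁺-commute _   (inj₁ refl) bS⁺c        = _ , bS⁺c , inj₁ refl
Refl⁺-commute _   (inj₂ aRb)  (inj₁ refl) = _ , inj₁ refl , inj₂ aRb
Refl⁺-commute R∘S≡S∘R {a} {b} {c} (inj₂ aRb) (inj₂ bSc)
  with proj₁ (R∘S≡S∘R a c) (b , aRb , bSc)
... | m , aSm , mRc = m , inj₂ aSm , inj₂ mRc

Star⊆equivalence : ∀ {W : Set} {T E : Rel W 0ℓ} →
  IsEquivalence E → T ⇒ E → Star T ⇒ E
Star⊆equivalence isEq T⇒E = fold _ (IsEquivalence.trans isEq ∘ T⇒E) (IsEquivalence.refl isEq)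

rooted⇒total : ∀ {W : Set} {Rh Rv E : Rel W 0ℓ} → Rooted Rh Rv →
  IsEquivalence E → (Rh ∪ᵣ Rv) ⇒ E → ∀ x y → E x y
rooted⇒total (r , r↝) isEq step⇒E x y =
  E.trans (E.sym (Star⊆equivalence isEq step⇒E (r↝ x)))
          (Star⊆equivalence isEq step⇒E (r↝ y))
  where module E = IsEquivalence isEq

module _ {W : Set} {Rh Rv : Rel W 0ℓ}
         (hPE : IsPseudoEquivalence Rh) (vPE : IsPseudoEquivalence Rv) where

  private
    module H = IsEquivalence (Refl⁺-isEquivalence hPE)
    module V = IsEquivalence (Refl⁺-isEquivalence vPE)

  commuting⇒Refl⁺-∘-isEquivalence : Commute Rh Rv →
    IsEquivalence (Refl⁺ Rv ∘ᵣ Refl⁺ Rh)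
  commuting⇒Refl⁺-∘-isEquivalence comm = record
    { refl  = _ , V.refl , H.refl
    ; sym   = λ (_ , aV⁺m , mH⁺b) → Refl⁺-commute comm (H.sym mH⁺b) (V.sym aV⁺m)
    ; trans = λ (_ , aV⁺m , mH⁺b) (_ , bV⁺n , nH⁺c) →
        let k , mV⁺k , kH⁺n = Refl⁺-commute comm mH⁺b bV⁺n
        in  k , V.trans aV⁺m mV⁺k , H.trans kH⁺n nH⁺c
    }

  grid-from-meets : (g : W → W → W) →
    (∀ x y → Refl⁺ Rv x (g x y)) → (∀ x y → Refl⁺ Rh (g x y) y) →
    GridOfBiClusters Rh Rv (Refl⁺-setoid vPE) (Refl⁺-setoid hPE)
  grid-from-meets g xV⁺g gH⁺y = record
    { g            = g
    ; g-cong       = λ xV⁺x' yH⁺y' →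
        H.trans (gH⁺y _ _) (H.trans yH⁺y' (H.sym (gH⁺y _ _))) ,
        V.trans (V.sym (xV⁺g _ _)) (V.trans xV⁺x' (xV⁺g _ _))
    ; g-injective  = λ (gH⁺g' , gV⁺g') →
        V.trans (xV⁺g _ _) (V.trans gV⁺g' (V.sym (xV⁺g _ _))) ,
        H.trans (H.sym (gH⁺y _ _)) (H.trans gH⁺g' (gH⁺y _ _))
    ; g-surjective = λ w → w , w , H.sym (gH⁺y w w) , xV⁺g w w
    ; horizontal   = λ x≉x' u∼g v∼g' →
        Refl⁺∧≢⇒R {R = Rh} (H.trans (row u∼g) (H.sym (row v∼g')))
                           (λ { refl → x≉x' (V.trans (V.sym (column u∼g)) (column v∼g')) })
    ; vertical     = λ y≉y' u∼g v∼g' →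
        Refl⁺∧≢⇒R {R = Rv} (V.trans (column u∼g) (V.sym (column v∼g')))
                           (λ { refl → y≉y' (H.trans (H.sym (row u∼g)) (row v∼g')) })
    }
    where
    row : ∀ {u x y} → u ∼⟨ Rh , Rv ⟩ g x y → Refl⁺ Rh u y
    row (uH⁺g , _) = H.trans uH⁺g (gH⁺y _ _)

    column : ∀ {u x y} → u ∼⟨ Rh , Rv ⟩ g x y → Refl⁺ Rv u x
    column (_ , uV⁺g) = V.trans uV⁺g (V.sym (xV⁺g _ _))

lemma4p1 : (W : Set) (Rh Rv : Rel W 0ℓ) →
    Rooted Rh Rv →
    IsPseudoEquivalence Rh →
    IsPseudoEquivalence Rv →
    Commute Rh Rv →
    RepresentableAsGrid Rh Rv
lemma4p1 W Rh Rv rooted hPE vPE comm =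
  _ , _ , grid-from-meets hPE vPE (λ x y → proj₁ (meet x y))
                                  (λ x y → proj₁ (proj₂ (meet x y)))
                                  (λ x y → proj₂ (proj₂ (meet x y)))
  where
  step⇒meet : (Rh ∪ᵣ Rv) ⇒ (Refl⁺ Rv ∘ᵣ Refl⁺ Rh)
  step⇒meet (inj₁ aRhb) = _ , inj₁ refl , inj₂ aRhb
  step⇒meet (inj₂ aRvb) = _ , inj₂ aRvb , inj₁ refl

  meet : ∀ x y → (Refl⁺ Rv ∘ᵣ Refl⁺ Rh) x y
  meet = rooted⇒total rooted (commuting⇒Refl⁺-∘-isEquivalence hPE vPE comm) step⇒meet
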